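{- For every resource $\lambda$-term $M$ and every $N$ (a resource $\lambda$-term or a finite sum of resource $\lambda$-terms), if $\lambda\beta^r\vdash M=N$ then $\lambda\beta^d\vdash M^d=N^d$.
   Context: Resource calculus: resource $\lambda$-terms $M::=x\mid\lambda x.M\mid MP$; resources $M^{(!)}::=M\mid M^!$; bags $P::=[M_1^{(!)},\dots,M_n^{(!)}]$ (finite multisets, $\uplus$ union), all up to $\alpha$-conversion. Sums: finite formal sums of terms (resp. of bags), commutative, associative, unit $0$. Constructors extend to sums: $\lambda x.\sum M_i=\sum\lambda x.M_i$, $(\sum M_i)(\sum P_j)=\sum M_iP_j$, $[\sum M_i]\uplus P=\sum[M_i]\uplus P$, $[(\sum_{i=1}^k M_i)^!]\uplus P=[M_1^!,\dots,M_k^!]\uplus P$. $A\{N/x\}$ is ordinary substitution (extended linearly in $A$). Linear substitution: $y\langle N/x\rangle=N$ if $y=x$, else $0$; $(\lambda y.M)\langle N/x\rangle=\lambda y.M\langle N/x\rangle$; $(MP)\langle N/x\rangle=M\langle N/x\rangle P+M(P\langle N/x\rangle)$; $[M]\langle N/x\rangle=[M\langle N/x\rangle]$; $[]\langle N/x\rangle=0$; $[M^!]\langle N/x\rangle=[M\langle N/x\rangle,M^!]$; $(P\uplus R)\langle N/x\rangle=P\langle N/x\rangle\uplus R+P\uplus R\langle N/x\rangle$; bilinear on sums. $\lambda\beta^r$ is the least relation on sums (of the same sort) that is an equivalence, compatible (if $M=\mathbb{M}$ then $\lambda x.M=\lambda x.\mathbb{M}$; if $M=\mathbb{M},P=\mathbb{P}$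 then $MP=\mathbb{M}\mathbb{P}$; if $M=\mathbb{M},P=\mathbb{P}$ then $[M^{(!)}]\uplus P=[\mathbb{M}^{(!)}]\uplus\mathbb{P}$; if $M_i=\mathbb{M}_i$ then $\sum M_i=\sum\mathbb{M}_i$) and contains $(\beta^r)$: $(\lambda x.M)[L_1,\dots,L_k,N_1^!,\dots,N_n^!]=M\langle L_1/x\rangle\cdots\langle L_k/x\rangle\{\sum_{i=1}^nN_i/x\}$. Differential $\lambda$-calculus: differential $\lambda$-terms $S::=0\mid s\mid s+S$, simple terms $s,t::=x\mid\lambda x.s\mid sT\mid\mathsf{D}s\cdot t$, modulo $\alpha$, AC of $+$ with unit $0$, and permutation of arguments in $\mathsf{D}^ns\cdot(t_1,\dots,t_n)$ ($\mathsf{D}^0s\cdot()=s$, $\mathsf{D}^{n+1}s\cdot(t,t_1..t_n)=\mathsf{D}^n(\mathsf{D}s\cdot t)\cdot(t_1..t_n)$); abbreviations $\lambda x.\sum s_i=\sum\lambda x.s_i$, $(\sum s_i)T=\sum s_iT$, $\mathsf{D}(\sum s_i)\cdot(\sum t_j)=\sum\mathsf{D}s_i\cdot t_j$. Substitution $S\{T/x\}$ (capture-free) and differential substitution $\frac{\partial S}{\partial x}\cdot T$: $\frac{\partial y}{\partial x}\cdot T=T$ if $y=x$ else $0$; $\frac{\partial(sU)}{\partial x}\cdot T=(\frac{\partial s}{\partial x}\cdot T)U+(\mathsf{D}s\cdot(\frac{\partial U}{\partial x}\cdot T))U$; $\frac{\partial(\lambda y.s)}{\partial x}\cdot T=\lambda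 y.\frac{\partial s}{\partial x}\cdot T$; $\frac{\partial(\mathsf{D}^ns\cdot(u_1..u_n))}{\partial x}\cdot T=\mathsf{D}^n(\frac{\partial s}{\partial x}\cdot T)\cdot(u_1..u_n)+\sum_i\mathsf{D}^ns\cdot(u_1,..,\frac{\partial u_i}{\partial x}\cdot T,..,u_n)$; $0\mapsto 0$; linear on sums. $\lambda\beta^d$ is the least equivalence on differential $\lambda$-terms, compatible with $\lambda$, application, linear application and sums, containing $(\lambda x.s)T=s\{T/x\}$ and $\mathsf{D}(\lambda x.s)\cdot t=\lambda x.\frac{\partial s}{\partial x}\cdot t$. Translation $(\cdot)^d$: $x^d=x$; $(\lambda x.M)^d=\lambda x.M^d$; $(M[L_1,\dots,L_k,N_1^!,\dots,N_n^!])^d=(\mathsf{D}^kM^d\cdot(L_1^d,\dots,L_k^d))(\sum_{i=1}^nN_i^d)$; $(\sum M_i)^d=\sum M_i^d$. -}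

module Defs where

open import Data.Nat using (ℕ; zero; suc; pred; _<ᵇ_; _≡ᵇ_)
open import Data.Bool using (if_then_else_)
open import Data.List using (List; []; _∷_; _++_; map; concat; concatMap)
open import Data.List.Relation.Binary.Pointwise using (Pointwise)
open import Data.List.Relation.Binary.Permutation.Propositional using (_↭_)

-- Conventions: variables are de Bruijn indices (this realises the
-- quotient by α-conversion).  Finite formal sums are lists, taken up to
-- permutation (commutativity/associativity, unit 0 = []).  Bags are
-- lists of resources, taken up to permutation (multisets).  The
-- quotients are realised by including the permutation equivalences in
-- the equational theories below.

substVar : {A : Set} → (ℕ → A) → A → ℕ → ℕ → A
substVar mk N k j = if j <ᵇ k then mk j else (if j ≡ᵇ k then N else mk (pred j))

shiftVar : ℕ → ℕ → ℕ
shiftVar c j = if j <ᵇ c then j else suc j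

mutual
  data RTerm : Set where
    var : ℕ → RTerm
    lam : RTerm → RTerm
    app : RTerm → List Res → RTerm

  data Res : Set where
    lin  : RTerm → Res
    bang : RTerm → Res

Bag : Set
Bag = List Res

RSum : Set
RSum = List RTerm

BSum : Set
BSum = List Bag

mutual
  shiftR : ℕ → RTerm → RTerm
  shiftR c (var j)   = var (shiftVar c j)
  shiftR c (lam M)   = lam (shiftR (suc c) M)
  shiftR c (app M P) = app (shiftR c M) (shiftB c P)

  shiftB : ℕ → Bag → Bag
  shiftB c []           = []
  shiftB c (lin M ∷ P)  = lin (shiftR c M) ∷ shiftB c P
  shiftB c (bang M ∷ P) = bang (shiftR c M) ∷ shiftB c P

lamS : RSum → RSum
lamS = map lam

appS : RSum → BSum → RSum
appS Ms Ps = concatMap (λ M → map (app M) Ps) Ms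

consLin : RSum → BSum → BSum
consLin Ms Ps = concatMap (λ M → map (lin M ∷_) Ps) Ms

consBang : RSum → BSum → BSum
consBang Ms Ps = map (map bang Ms ++_) Ps

mutual
  rsub : ℕ → RSum → RTerm → RSum
  rsub k N (var j)   = substVar (λ i → var i ∷ []) N k j
  rsub k N (lam M)   = lamS (rsub (suc k) (map (shiftR 0) N) M)
  rsub k N (app M P) = appS (rsub k N M) (bsub k N P)

  bsub : ℕ → RSum → Bag → BSum
  bsub k N []           = [] ∷ []
  bsub k N (lin M ∷ P)  = consLin (rsub k N M) (bsub k N P)
  bsub k N (bang M ∷ P) = consBang (rsub k N M) (bsub k N P)

rsubS : ℕ → RSum → RSum → RSum
rsubS k N Ms = concatMap (rsub k N) Ms

-- Linear substitution M⟨L/x_k⟩ (x_k stays free)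
mutual
  lsub : ℕ → RTerm → RTerm → RSum
  lsub k L (var j)   = if j ≡ᵇ k then L ∷ [] else []
  lsub k L (lam M)   = lamS (lsub (suc k) (shiftR 0 L) M)
  lsub k L (app M P) = appS (lsub k L M) (P ∷ []) ++ appS (M ∷ []) (lsubB k L P)

  lsubB : ℕ → RTerm → Bag → BSum
  lsubB k L []           = []
  lsubB k L (lin M ∷ P)  =
    consLin (lsub k L M) (P ∷ []) ++ map (lin M ∷_) (lsubB k L P)
  lsubB k L (bang M ∷ P) =
    consLin (lsub k L M) ((bang M ∷ P) ∷ []) ++ map (bang M ∷_) (lsubB k L P)

lsubS : ℕ → RTerm → RSum → RSum
lsubS k L Ms = concatMap (lsub k L) Ms

lsubs : ℕ → List RTerm → RSum → RSum
lsubs k []       Ms = Ms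
lsubs k (L ∷ Ls) Ms = lsubs k Ls (lsubS k L Ms)

infix 4 _≈r_ _≈b_
mutual
  data _≈r_ : RSum → RSum → Set where
    r-refl  : ∀ {S} → S ≈r S
    r-sym   : ∀ {S T} → S ≈r T → T ≈r S
    r-trans : ∀ {S T U} → S ≈r T → T ≈r U → S ≈r U
    r-perm  : ∀ {S T} → S ↭ T → S ≈r T
    r-lam   : ∀ {M 𝕄} → (M ∷ []) ≈r 𝕄 → (lam M ∷ []) ≈r lamS 𝕄
    r-app   : ∀ {M 𝕄 P ℙ} → (M ∷ []) ≈r 𝕄 → (P ∷ []) ≈b ℙ →
              (app M P ∷ []) ≈r appS 𝕄 ℙ
    r-sum   : ∀ {Ms 𝕄s} → Pointwise (λ M 𝕄 → (M ∷ []) ≈r 𝕄) Ms 𝕄s →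
              Ms ≈r concat 𝕄s
    r-beta  : ∀ M Ls Ns →
              (app (lam M) (map lin Ls ++ map bang Ns) ∷ [])
                ≈r rsubS 0 Ns (lsubs 0 (map (shiftR 0) Ls) (M ∷ []))

  data _≈b_ : BSum → BSum → Set where
    b-refl    : ∀ {S} → S ≈b S
    b-sym     : ∀ {S T} → S ≈b T → T ≈b S
    b-trans   : ∀ {S T U} → S ≈b T → T ≈b U → S ≈b U
    b-perm    : ∀ {S T} → S ↭ T → S ≈b T
    b-bagperm : ∀ {P Q} → P ↭ Q → (P ∷ []) ≈b (Q ∷ [])
    b-lin     : ∀ {M 𝕄 P ℙ} → (M ∷ []) ≈r 𝕄 → (P ∷ []) ≈b ℙ →
                ((lin M ∷ P) ∷ []) ≈b consLin 𝕄 ℙ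
    b-bang    : ∀ {M 𝕄 P ℙ} → (M ∷ []) ≈r 𝕄 → (P ∷ []) ≈b ℙ →
                ((bang M ∷ P) ∷ []) ≈b consBang 𝕄 ℙ
    b-sum     : ∀ {Ps ℙs} → Pointwise (λ P ℙ → (P ∷ []) ≈b ℙ) Ps ℙs →
                Ps ≈b concat ℙs

-- simple terms: x | λx.s | s T | D s · t   (T a sum)
data DTerm : Set where
  var : ℕ → DTerm
  lam : DTerm → DTerm
  app : DTerm → List DTerm → DTerm
  dap : DTerm → DTerm → DTerm

DSum : Set
DSum = List DTerm

mutual
  shiftD : ℕ → DTerm → DTerm
  shiftD c (var j)   = var (shiftVar c j)
  shiftD c (lam s)   = lam (shiftD (suc c) s)
  shiftD c (app s T) = app (shiftD c s) (shiftDS c T)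
  shiftD c (dap s t) = dap (shiftD c s) (shiftD c t)

  shiftDS : ℕ → DSum → DSum
  shiftDS c []      = []
  shiftDS c (t ∷ T) = shiftD c t ∷ shiftDS c T

appDS : DSum → DSum → DSum
appDS S T = map (λ s → app s T) S

dapDS : DSum → DSum → DSum
dapDS S T = concatMap (λ s → map (dap s) T) S

Dn : DTerm → List DTerm → DTerm
Dn s []       = s
Dn s (t ∷ ts) = Dn (dap s t) ts

mutual
  subD : ℕ → DSum → DTerm → DSum
  subD k T (var j)   = substVar (λ i → var i ∷ []) T k j
  subD k T (lam s)   = map lam (subD (suc k) (shiftDS 0 T) s)
  subD k T (app s U) = appDS (subD k T s) (subDS k T U)
  subD k T (dap s u) = dapDS (subD k T s) (subD k T u)

  subDS : ℕ → DSum → DSum → DSum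
  subDS k T []      = []
  subDS k T (u ∷ U) = subD k T u ++ subDS k T U

-- differential substitution ∂S/∂x_k · T  (the D^n clause is taken with
-- n = 1, which by the definition of D^n yields the general clause)
mutual
  dsubD : ℕ → DSum → DTerm → DSum
  dsubD k T (var j)   = if j ≡ᵇ k then T else []
  dsubD k T (lam s)   = map lam (dsubD (suc k) (shiftDS 0 T) s)
  dsubD k T (app s U) =
    appDS (dsubD k T s) U ++ appDS (dapDS (s ∷ []) (dsubDS k T U)) U
  dsubD k T (dap s u) =
    dapDS (dsubD k T s) (u ∷ []) ++ dapDS (s ∷ []) (dsubD k T u)

  dsubDS : ℕ → DSum → DSum → DSum
  dsubDS k T []      = []
  dsubDS k T (u ∷ U) = dsubD k T u ++ dsubDS k T U

infix 4 _≈d_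
data _≈d_ : DSum → DSum → Set where
  d-refl  : ∀ {S} → S ≈d S
  d-sym   : ∀ {S T} → S ≈d T → T ≈d S
  d-trans : ∀ {S T U} → S ≈d T → T ≈d U → S ≈d U
  d-perm  : ∀ {S T} → S ↭ T → S ≈d T
  -- quotient: permutation of arguments of D^n
  d-dswap : ∀ {s t u} → (dap (dap s t) u ∷ []) ≈d (dap (dap s u) t ∷ [])
  d-lam   : ∀ {S S'} → S ≈d S' → map lam S ≈d map lam S'
  d-app   : ∀ {S S' T T'} → S ≈d S' → T ≈d T' → appDS S T ≈d appDS S' T'
  d-dap   : ∀ {S S' T T'} → S ≈d S' → T ≈d T' → dapDS S T ≈d dapDS S' T'
  d-sum   : ∀ {S S' T T'} → S ≈d S' → T ≈d T' → S ++ T ≈d S' ++ T'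
  d-beta  : ∀ s T → (app (lam s) T ∷ []) ≈d subD 0 T s
  d-dbeta : ∀ s t → (dap (lam s) t ∷ []) ≈d map lam (dsubD 0 (shiftD 0 t ∷ []) s)

mutual
  _ᵈ : RTerm → DTerm
  var j ᵈ   = var j
  lam M ᵈ   = lam (M ᵈ)
  app M P ᵈ = app (Dn (M ᵈ) (linsᵈ P)) (bangsᵈ P)

  linsᵈ : Bag → List DTerm
  linsᵈ []           = []
  linsᵈ (lin M ∷ P)  = M ᵈ ∷ linsᵈ P
  linsᵈ (bang M ∷ P) = linsᵈ P

  bangsᵈ : Bag → DSum
  bangsᵈ []           = []
  bangsᵈ (lin M ∷ P)  = bangsᵈ P
  bangsᵈ (bang M ∷ P) = M ᵈ ∷ bangsᵈ P

_ᵈˢ : RSum → DSum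
Ms ᵈˢ = map _ᵈ Ms

-- The translation commutes with
-- shifting and sends a linear substitution M⟨L/x⟩ to the differential
-- substitution ∂Mᵈ/∂x·Lᵈ and an ordinary substitution to an ordinary one.  These
-- hold not merely in λβ^d but up to the structural congruence _∼_ (λβ^d without
-- its β-rules), which both substitutions preserve.  So the translation
-- (Dᵏ(λx.Mᵈ)·(L₁ᵈ,…,Lₖᵈ))(ΣNᵢᵈ) of a (β^r)-redex reduces by k differential
-- β-steps and one β-step to the translation of its contractum.  Equations
-- between bags are translated together with an arbitrary head and an arbitrary
-- sum of further reusable arguments, which makes them amenable to induction.

module Submission where

open import Defs
open import Data.Nat using (ℕ; suc; _<ᵇ_; _≡ᵇ_)
open import Data.Bool using (true; false)
open import Data.List using (List; []; _∷_; [_]; _++_; map; concat; concatMap; mapMaybe)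
open import Data.Maybe using (Maybe; just; nothing)
open import Data.List.Properties
  using (++-assoc; ++-identityʳ; map-++; map-cong; map-∘; map-id; concatMap-++; concatMap-cong; concatMap-map; map-concatMap)
open import Data.List.Relation.Binary.Pointwise using (Pointwise; []; _∷_)
open import Data.List.Relation.Binary.Permutation.Propositional
  using (_↭_; refl; prep; swap; trans; ↭-sym; ↭-trans; ↭-reflexive; module PermutationReasoning)
open import Data.List.Relation.Binary.Permutation.Propositional.Properties
  using (++⁺ˡ; ++⁺; shifts; map⁺; mapMaybe-↭; ++-commutativeMonoid)
open import Algebra.Bundles using (CommutativeMonoid)
import Algebra.Properties.CommutativeSemigroup as CommutativeSemigroupProperties
open import Relation.Binary.Bundles using (Setoid)
import Relation.Binary.Reasoning.Setoid as SetoidReasoning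
open import Relation.Binary.PropositionalEquality as ≡ using (_≡_; refl; cong; cong₂)

private
  variable
    A B C : Set

  module ++-↭-Properties {A : Set} = CommutativeSemigroupProperties
    (CommutativeMonoid.commutativeSemigroup (++-commutativeMonoid {A = A}))

map-as-concatMap : (f : A → B) (xs : List A) → map f xs ≡ concatMap (λ x → [ f x ]) xs
map-as-concatMap f []       = refl
map-as-concatMap f (x ∷ xs) = cong (f x ∷_) (map-as-concatMap f xs)

concatMap-const-[] : (xs : List A) → concatMap (λ _ → []) xs ≡ ([] {A = B})
concatMap-const-[] []       = refl
concatMap-const-[] (x ∷ xs) = concatMap-const-[] xs

concatMap-concatMap : (f : B → List C) (g : A → List B) (xs : List A) →
                      concatMap f (concatMap g xs) ≡ concatMap (λ x → concatMap f (g x)) xs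
concatMap-concatMap f g []       = refl
concatMap-concatMap f g (x ∷ xs) =
  ≡.trans (concatMap-++ f (g x) _) (cong (concatMap f (g x) ++_) (concatMap-concatMap f g xs))

concatMap-↭ : (f : A → List B) {xs ys : List A} → xs ↭ ys → concatMap f xs ↭ concatMap f ys
concatMap-↭ f refl         = refl
concatMap-↭ f (prep x p)   = ++⁺ˡ (f x) (concatMap-↭ f p)
concatMap-↭ f (swap x y p) = ↭-trans (shifts (f x) (f y)) (++⁺ˡ (f y) (++⁺ˡ (f x) (concatMap-↭ f p)))
concatMap-↭ f (trans p q)  = ↭-trans (concatMap-↭ f p) (concatMap-↭ f q)

concatMap-++-↭ : (f g : A → List B) (xs : List A) →
                 concatMap (λ x → f x ++ g x) xs ↭ concatMap f xs ++ concatMap g xs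
concatMap-++-↭ f g []       = refl
concatMap-++-↭ f g (x ∷ xs) =
  ↭-trans (++⁺ˡ (f x ++ g x) (concatMap-++-↭ f g xs)) (++-↭-Properties.interchange (f x) (g x) _ _)

concatMap-comm-↭ : (h : A → B → List C) (xs : List A) (ys : List B) →
                   concatMap (λ x → concatMap (h x) ys) xs ↭ concatMap (λ y → concatMap (λ x → h x y) xs) ys
concatMap-comm-↭ h []       ys = ↭-reflexive (≡.sym (concatMap-const-[] ys))
concatMap-comm-↭ h (x ∷ xs) ys =
  ↭-trans (++⁺ˡ (concatMap (h x) ys) (concatMap-comm-↭ h xs ys))
          (↭-sym (concatMap-++-↭ (h x) (λ y → concatMap (λ x → h x y) xs) ys))

appDS-++ : (S S' T : DSum) → appDS (S ++ S') T ≡ appDS S T ++ appDS S' T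
appDS-++ S S' T = map-++ (λ s → app s T) S S'

dapDS-++ˡ : (S S' T : DSum) → dapDS (S ++ S') T ≡ dapDS S T ++ dapDS S' T
dapDS-++ˡ S S' T = concatMap-++ (λ s → map (dap s) T) S S'

dapDS-++ʳ : (S T T' : DSum) → dapDS S (T ++ T') ↭ dapDS S T ++ dapDS S T'
dapDS-++ʳ []      T T' = refl
dapDS-++ʳ (s ∷ S) T T' = begin
  map (dap s) (T ++ T') ++ dapDS S (T ++ T')
    ≡⟨ cong (_++ dapDS S (T ++ T')) (map-++ (dap s) T T') ⟩
  (map (dap s) T ++ map (dap s) T') ++ dapDS S (T ++ T')
    ↭⟨ ++⁺ˡ (map (dap s) T ++ map (dap s) T') (dapDS-++ʳ S T T') ⟩
  (map (dap s) T ++ map (dap s) T') ++ (dapDS S T ++ dapDS S T')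
    ↭⟨ ++-↭-Properties.interchange (map (dap s) T) _ _ _ ⟩
  dapDS (s ∷ S) T ++ dapDS (s ∷ S) T'
    ∎
  where open PermutationReasoning

dapDS-concatMapˡ : (g : A → DSum) (xs : List A) (T : DSum) →
                   dapDS (concatMap g xs) T ≡ concatMap (λ x → dapDS (g x) T) xs
dapDS-concatMapˡ g xs T = concatMap-concatMap (λ s → map (dap s) T) g xs

dapDS-mapˡ : (f : DTerm → DTerm) (S T : DSum) → dapDS (map f S) T ≡ concatMap (λ s → map (dap (f s)) T) S
dapDS-mapˡ f S T = concatMap-map (λ s → map (dap s) T) f S

dapDS-[-]ˡ : (s : DTerm) (T : DSum) → dapDS [ s ] T ≡ map (dap s) T
dapDS-[-]ˡ s T = ++-identityʳ (map (dap s) T)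

dapDS-[-]ʳ : (S : DSum) (t : DTerm) → dapDS S [ t ] ≡ map (λ s → dap s t) S
dapDS-[-]ʳ S t = ≡.sym (map-as-concatMap (λ s → dap s t) S)

dapDS-[-]-++ʳ : ∀ s T T' → dapDS [ s ] (T ++ T') ≡ dapDS [ s ] T ++ dapDS [ s ] T'
dapDS-[-]-++ʳ s T T' = begin
  dapDS [ s ] (T ++ T')              ≡⟨ dapDS-[-]ˡ s (T ++ T') ⟩
  map (dap s) (T ++ T')              ≡⟨ map-++ (dap s) T T' ⟩
  map (dap s) T ++ map (dap s) T'    ≡⟨ cong₂ _++_ (dapDS-[-]ˡ s T) (dapDS-[-]ˡ s T') ⟨
  dapDS [ s ] T ++ dapDS [ s ] T'    ∎
  where open ≡.≡-Reasoning

-- λβ^d without its two β-rules.  Unlike _≈d_ it is preserved by both kinds of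
-- substitution, which is what the translation of (β^r) needs.
infix 4 _∼_
data _∼_ : DSum → DSum → Set where
  ∼-refl  : ∀ {S} → S ∼ S
  ∼-sym   : ∀ {S T} → S ∼ T → T ∼ S
  ∼-trans : ∀ {S T U} → S ∼ T → T ∼ U → S ∼ U
  ∼-perm  : ∀ {S T} → S ↭ T → S ∼ T
  ∼-dswap : ∀ {s t u} → [ dap (dap s t) u ] ∼ [ dap (dap s u) t ]
  ∼-lam   : ∀ {S S'} → S ∼ S' → map lam S ∼ map lam S'
  ∼-app   : ∀ {S S' T T'} → S ∼ S' → T ∼ T' → appDS S T ∼ appDS S' T'
  ∼-dap   : ∀ {S S' T T'} → S ∼ S' → T ∼ T' → dapDS S T ∼ dapDS S' T'
  ∼-sum   : ∀ {S S' T T'} → S ∼ S' → T ∼ T' → S ++ T ∼ S' ++ T'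

∼⇒≈d : ∀ {S T} → S ∼ T → S ≈d T
∼⇒≈d ∼-refl        = d-refl
∼⇒≈d (∼-sym p)     = d-sym (∼⇒≈d p)
∼⇒≈d (∼-trans p q) = d-trans (∼⇒≈d p) (∼⇒≈d q)
∼⇒≈d (∼-perm p)    = d-perm p
∼⇒≈d ∼-dswap       = d-dswap
∼⇒≈d (∼-lam p)     = d-lam (∼⇒≈d p)
∼⇒≈d (∼-app p q)   = d-app (∼⇒≈d p) (∼⇒≈d q)
∼⇒≈d (∼-dap p q)   = d-dap (∼⇒≈d p) (∼⇒≈d q)
∼⇒≈d (∼-sum p q)   = d-sum (∼⇒≈d p) (∼⇒≈d q)

∼-reflexive : ∀ {S T} → S ≡ T → S ∼ T
∼-reflexive refl = ∼-refl

≈d-reflexive : ∀ {S T} → S ≡ T → S ≈d T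
≈d-reflexive refl = d-refl

∼-setoid : Setoid _ _
∼-setoid = record
  { Carrier = DSum ; _≈_ = _∼_
  ; isEquivalence = record { refl = ∼-refl ; sym = ∼-sym ; trans = ∼-trans } }

≈d-setoid : Setoid _ _
≈d-setoid = record
  { Carrier = DSum ; _≈_ = _≈d_
  ; isEquivalence = record { refl = d-refl ; sym = d-sym ; trans = d-trans } }

module ∼-Reasoning = SetoidReasoning ∼-setoid
module ≈d-Reasoning = SetoidReasoning ≈d-setoid

concatMap-cong-∼ : {f g : A → DSum} → (∀ x → f x ∼ g x) →
                   (xs : List A) → concatMap f xs ∼ concatMap g xs
concatMap-cong-∼ f∼g []       = ∼-refl
concatMap-cong-∼ f∼g (x ∷ xs) = ∼-sum (f∼g x) (concatMap-cong-∼ f∼g xs)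

concatMap-cong-≈d : {f g : A → DSum} → (∀ x → f x ≈d g x) →
                    (xs : List A) → concatMap f xs ≈d concatMap g xs
concatMap-cong-≈d f≈g []       = d-refl
concatMap-cong-≈d f≈g (x ∷ xs) = d-sum (f≈g x) (concatMap-cong-≈d f≈g xs)

dapDS-dapDS : (S T U : DSum) →
              dapDS (dapDS S T) U ≡ concatMap (λ s → concatMap (λ t → map (dap (dap s t)) U) T) S
dapDS-dapDS S T U =
  ≡.trans (dapDS-concatMapˡ (λ s → map (dap s) T) S U) (concatMap-cong (λ s → dapDS-mapˡ (dap s) T U) S)

dapDS-swap : (S T U : DSum) → dapDS (dapDS S T) U ∼ dapDS (dapDS S U) T
dapDS-swap S T U = begin
  dapDS (dapDS S T) U                                              ≡⟨ dapDS-dapDS S T U ⟩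
  concatMap (λ s → concatMap (λ t → map (dap (dap s t)) U) T) S   ≈⟨ concatMap-cong-∼ swapped S ⟩
  concatMap (λ s → concatMap (λ u → map (dap (dap s u)) T) U) S   ≡⟨ dapDS-dapDS S U T ⟨
  dapDS (dapDS S U) T                                              ∎
  where
  open ∼-Reasoning
  swapped : ∀ s → concatMap (λ t → map (dap (dap s t)) U) T ∼ concatMap (λ u → map (dap (dap s u)) T) U
  swapped s = begin
    concatMap (λ t → map (dap (dap s t)) U) T
      ≡⟨ concatMap-cong (λ t → map-as-concatMap (dap (dap s t)) U) T ⟩
    concatMap (λ t → concatMap (λ u → [ dap (dap s t) u ]) U) T
      ≈⟨ ∼-perm (concatMap-comm-↭ (λ t u → [ dap (dap s t) u ]) T U) ⟩
    concatMap (λ u → concatMap (λ t → [ dap (dap s t) u ]) T) U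
      ≈⟨ concatMap-cong-∼ (λ u → concatMap-cong-∼ (λ t → ∼-dswap) T) U ⟩
    concatMap (λ u → concatMap (λ t → [ dap (dap s u) t ]) T) U
      ≡⟨ concatMap-cong (λ u → map-as-concatMap (dap (dap s u)) T) U ⟨
    concatMap (λ u → map (dap (dap s u)) T) U
      ∎

module AdditiveExtension (f : DTerm → DSum) (F : DSum → DSum)
                         (F-[] : F [] ≡ []) (F-∷ : ∀ u U → F (u ∷ U) ≡ f u ++ F U) where

  extension-concatMap : ∀ U → F U ≡ concatMap f U
  extension-concatMap []      = F-[]
  extension-concatMap (u ∷ U) = ≡.trans (F-∷ u U) (cong (f u ++_) (extension-concatMap U))

  extension-++ : ∀ U V → F (U ++ V) ≡ F U ++ F V
  extension-++ U V = begin
    F (U ++ V)                        ≡⟨ extension-concatMap (U ++ V) ⟩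
    concatMap f (U ++ V)              ≡⟨ concatMap-++ f U V ⟩
    concatMap f U ++ concatMap f V    ≡⟨ cong₂ _++_ (extension-concatMap U) (extension-concatMap V) ⟨
    F U ++ F V                        ∎
    where open ≡.≡-Reasoning

  extension-↭ : ∀ {U V} → U ↭ V → F U ↭ F V
  extension-↭ {U} {V} p = begin
    F U              ≡⟨ extension-concatMap U ⟩
    concatMap f U    ↭⟨ concatMap-↭ f p ⟩
    concatMap f V    ≡⟨ extension-concatMap V ⟨
    F V              ∎
    where open PermutationReasoning

module SubDS (k : ℕ) (T : DSum) = AdditiveExtension (subD k T) (subDS k T) refl (λ _ _ → refl)
module DsubDS (k : ℕ) (T : DSum) = AdditiveExtension (dsubD k T) (dsubDS k T) refl (λ _ _ → refl)

module _ (k : ℕ) (T : DSum) where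

  subDS-map-lam : ∀ S → subDS k T (map lam S) ≡ map lam (subDS (suc k) (shiftDS 0 T) S)
  subDS-map-lam []      = refl
  subDS-map-lam (s ∷ S) =
    ≡.trans (cong (_ ++_) (subDS-map-lam S)) (≡.sym (map-++ lam (subD (suc k) (shiftDS 0 T) s) _))

  dsubDS-map-lam : ∀ S → dsubDS k T (map lam S) ≡ map lam (dsubDS (suc k) (shiftDS 0 T) S)
  dsubDS-map-lam []      = refl
  dsubDS-map-lam (s ∷ S) =
    ≡.trans (cong (_ ++_) (dsubDS-map-lam S)) (≡.sym (map-++ lam (dsubD (suc k) (shiftDS 0 T) s) _))

  subDS-appDS : ∀ S U → subDS k T (appDS S U) ≡ appDS (subDS k T S) (subDS k T U)
  subDS-appDS []      U = refl
  subDS-appDS (s ∷ S) U =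
    ≡.trans (cong (_ ++_) (subDS-appDS S U)) (≡.sym (appDS-++ (subD k T s) (subDS k T S) (subDS k T U)))

  dsubDS-appDS : ∀ S U → dsubDS k T (appDS S U) ↭ appDS (dsubDS k T S) U ++ appDS (dapDS S (dsubDS k T U)) U
  dsubDS-appDS []      U = refl
  dsubDS-appDS (s ∷ S) U = begin
    (appDS (dsubD k T s) U ++ appDS (dapDS [ s ] ∂U) U) ++ dsubDS k T (appDS S U)
      ↭⟨ ++⁺ˡ (appDS (dsubD k T s) U ++ appDS (dapDS [ s ] ∂U) U) (dsubDS-appDS S U) ⟩
    (appDS (dsubD k T s) U ++ appDS (dapDS [ s ] ∂U) U) ++ (appDS (dsubDS k T S) U ++ appDS (dapDS S ∂U) U)
      ↭⟨ ++-↭-Properties.interchange (appDS (dsubD k T s) U) _ _ _ ⟩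
    (appDS (dsubD k T s) U ++ appDS (dsubDS k T S) U) ++ (appDS (dapDS [ s ] ∂U) U ++ appDS (dapDS S ∂U) U)
      ≡⟨ cong₂ _++_ (appDS-++ (dsubD k T s) (dsubDS k T S) U) (appDS-++ (dapDS [ s ] ∂U) (dapDS S ∂U) U) ⟨
    appDS (dsubD k T s ++ dsubDS k T S) U ++ appDS (dapDS [ s ] ∂U ++ dapDS S ∂U) U
      ≡⟨ cong (λ z → appDS (dsubDS k T (s ∷ S)) U ++ appDS (z ++ dapDS S ∂U) U) (dapDS-[-]ˡ s ∂U) ⟩
    appDS (dsubDS k T (s ∷ S)) U ++ appDS (dapDS (s ∷ S) ∂U) U
      ∎
    where
    open PermutationReasoning
    ∂U = dsubDS k T U

  subDS-dapDS : ∀ S U → subDS k T (dapDS S U) ↭ dapDS (subDS k T S) (subDS k T U)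
  subDS-dapDS []      U = refl
  subDS-dapDS (s ∷ S) U = begin
    subDS k T (map (dap s) U ++ dapDS S U)
      ≡⟨ SubDS.extension-++ k T (map (dap s) U) (dapDS S U) ⟩
    subDS k T (map (dap s) U) ++ subDS k T (dapDS S U)
      ↭⟨ ++⁺ (subDS-map-dap U) (subDS-dapDS S U) ⟩
    dapDS (subD k T s) (subDS k T U) ++ dapDS (subDS k T S) (subDS k T U)
      ≡⟨ dapDS-++ˡ (subD k T s) (subDS k T S) (subDS k T U) ⟨
    dapDS (subD k T s ++ subDS k T S) (subDS k T U)
      ∎
    where
    open PermutationReasoning
    subDS-map-dap : ∀ U → subDS k T (map (dap s) U) ↭ dapDS (subD k T s) (subDS k T U)
    subDS-map-dap []      = ↭-reflexive (≡.sym (concatMap-const-[] (subD k T s)))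
    subDS-map-dap (u ∷ U) =
      ↭-trans (++⁺ˡ (dapDS (subD k T s) (subD k T u)) (subDS-map-dap U))
              (↭-sym (dapDS-++ʳ (subD k T s) (subD k T u) (subDS k T U)))

  dsubDS-dapDS : ∀ S U → dsubDS k T (dapDS S U) ↭ dapDS (dsubDS k T S) U ++ dapDS S (dsubDS k T U)
  dsubDS-dapDS []      U = refl
  dsubDS-dapDS (s ∷ S) U = begin
    dsubDS k T (map (dap s) U ++ dapDS S U)
      ≡⟨ DsubDS.extension-++ k T (map (dap s) U) (dapDS S U) ⟩
    dsubDS k T (map (dap s) U) ++ dsubDS k T (dapDS S U)
      ↭⟨ ++⁺ (dsubDS-map-dap U) (dsubDS-dapDS S U) ⟩
    (dapDS (dsubD k T s) U ++ map (dap s) (dsubDS k T U)) ++ (dapDS (dsubDS k T S) U ++ dapDS S (dsubDS k T U))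
      ↭⟨ ++-↭-Properties.interchange (dapDS (dsubD k T s) U) _ _ _ ⟩
    (dapDS (dsubD k T s) U ++ dapDS (dsubDS k T S) U) ++ dapDS (s ∷ S) (dsubDS k T U)
      ≡⟨ cong (_++ dapDS (s ∷ S) (dsubDS k T U)) (dapDS-++ˡ (dsubD k T s) (dsubDS k T S) U) ⟨
    dapDS (dsubDS k T (s ∷ S)) U ++ dapDS (s ∷ S) (dsubDS k T U)
      ∎
    where
    open PermutationReasoning
    ∂s = dsubD k T s
    dsubDS-map-dap : ∀ U → dsubDS k T (map (dap s) U) ↭ dapDS ∂s U ++ map (dap s) (dsubDS k T U)
    dsubDS-map-dap []      = ↭-reflexive (≡.sym (≡.trans (++-identityʳ _) (concatMap-const-[] ∂s)))
    dsubDS-map-dap (u ∷ U) = begin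
      (dapDS ∂s [ u ] ++ dapDS [ s ] (dsubD k T u)) ++ dsubDS k T (map (dap s) U)
        ↭⟨ ++⁺ˡ (dapDS ∂s [ u ] ++ dapDS [ s ] (dsubD k T u)) (dsubDS-map-dap U) ⟩
      (dapDS ∂s [ u ] ++ dapDS [ s ] (dsubD k T u)) ++ (dapDS ∂s U ++ map (dap s) (dsubDS k T U))
        ↭⟨ ++-↭-Properties.interchange (dapDS ∂s [ u ]) _ _ _ ⟩
      (dapDS ∂s [ u ] ++ dapDS ∂s U) ++ (dapDS [ s ] (dsubD k T u) ++ map (dap s) (dsubDS k T U))
        ↭⟨ ++⁺ (↭-sym (dapDS-++ʳ ∂s [ u ] U)) (↭-reflexive (cong (_++ _) (dapDS-[-]ˡ s (dsubD k T u)))) ⟩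
      dapDS ∂s (u ∷ U) ++ (map (dap s) (dsubD k T u) ++ map (dap s) (dsubDS k T U))
        ≡⟨ cong (dapDS ∂s (u ∷ U) ++_) (map-++ (dap s) (dsubD k T u) (dsubDS k T U)) ⟨
      dapDS ∂s (u ∷ U) ++ map (dap s) (dsubDS k T (u ∷ U))
        ∎

  subDS-dswap : ∀ s t u → subDS k T [ dap (dap s t) u ] ∼ subDS k T [ dap (dap s u) t ]
  subDS-dswap s t u = begin
    subDS k T [ dap (dap s t) u ]                        ≡⟨ ++-identityʳ _ ⟩
    dapDS (dapDS (subD k T s) (subD k T t)) (subD k T u) ≈⟨ dapDS-swap (subD k T s) (subD k T t) (subD k T u) ⟩
    dapDS (dapDS (subD k T s) (subD k T u)) (subD k T t) ≡⟨ ++-identityʳ _ ⟨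
    subDS k T [ dap (dap s u) t ]                        ∎
    where open ∼-Reasoning

  dsubDS-dswap : ∀ s t u → dsubDS k T [ dap (dap s t) u ] ∼ dsubDS k T [ dap (dap s u) t ]
  dsubDS-dswap s t u = begin
    dsubDS k T [ dap (dap s t) u ]
      ≡⟨ expand t u ⟩
    (dapDS (dapDS ∂s [ t ]) [ u ] ++ dapDS (dapDS [ s ] ∂t) [ u ]) ++ dapDS (dapDS [ s ] [ t ]) ∂u
      ≈⟨ ∼-sum (∼-sum (dapDS-swap ∂s [ t ] [ u ]) (dapDS-swap [ s ] ∂t [ u ])) (dapDS-swap [ s ] [ t ] ∂u) ⟩
    (dapDS (dapDS ∂s [ u ]) [ t ] ++ dapDS (dapDS [ s ] [ u ]) ∂t) ++ dapDS (dapDS [ s ] ∂u) [ t ]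
      ≈⟨ ∼-perm (++-↭-Properties.xy∙z≈xz∙y (dapDS (dapDS ∂s [ u ]) [ t ]) _ _) ⟩
    (dapDS (dapDS ∂s [ u ]) [ t ] ++ dapDS (dapDS [ s ] ∂u) [ t ]) ++ dapDS (dapDS [ s ] [ u ]) ∂t
      ≡⟨ expand u t ⟨
    dsubDS k T [ dap (dap s u) t ]
      ∎
    where
    open ∼-Reasoning
    ∂s = dsubD k T s
    ∂t = dsubD k T t
    ∂u = dsubD k T u
    expand : ∀ t u → dsubDS k T [ dap (dap s t) u ] ≡
             (dapDS (dapDS ∂s [ t ]) [ u ] ++ dapDS (dapDS [ s ] (dsubD k T t)) [ u ]) ++
             dapDS (dapDS [ s ] [ t ]) (dsubD k T u)
    expand t u =
      ≡.trans (++-identityʳ _)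
              (cong (_++ dapDS (dapDS [ s ] [ t ]) (dsubD k T u))
                    (dapDS-++ˡ (dapDS ∂s [ t ]) (dapDS [ s ] (dsubD k T t)) [ u ]))

subDS-resp-∼ : ∀ k T {S S'} → S ∼ S' → subDS k T S ∼ subDS k T S'
subDS-resp-∼ k T ∼-refl        = ∼-refl
subDS-resp-∼ k T (∼-sym p)     = ∼-sym (subDS-resp-∼ k T p)
subDS-resp-∼ k T (∼-trans p q) = ∼-trans (subDS-resp-∼ k T p) (subDS-resp-∼ k T q)
subDS-resp-∼ k T (∼-perm p)    = ∼-perm (SubDS.extension-↭ k T p)
subDS-resp-∼ k T (∼-dswap {s} {t} {u}) = subDS-dswap k T s t u
subDS-resp-∼ k T (∼-lam {S} {S'} p) = begin
  subDS k T (map lam S)                        ≡⟨ subDS-map-lam k T S ⟩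
  map lam (subDS (suc k) (shiftDS 0 T) S)      ≈⟨ ∼-lam (subDS-resp-∼ (suc k) (shiftDS 0 T) p) ⟩
  map lam (subDS (suc k) (shiftDS 0 T) S')     ≡⟨ subDS-map-lam k T S' ⟨
  subDS k T (map lam S')                       ∎
  where open ∼-Reasoning
subDS-resp-∼ k T (∼-app {S} {S'} {U} {U'} p q) = begin
  subDS k T (appDS S U)                   ≡⟨ subDS-appDS k T S U ⟩
  appDS (subDS k T S) (subDS k T U)       ≈⟨ ∼-app (subDS-resp-∼ k T p) (subDS-resp-∼ k T q) ⟩
  appDS (subDS k T S') (subDS k T U')     ≡⟨ subDS-appDS k T S' U' ⟨
  subDS k T (appDS S' U')                 ∎
  where open ∼-Reasoning
subDS-resp-∼ k T (∼-dap {S} {S'} {U} {U'} p q) = begin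
  subDS k T (dapDS S U)                   ≈⟨ ∼-perm (subDS-dapDS k T S U) ⟩
  dapDS (subDS k T S) (subDS k T U)       ≈⟨ ∼-dap (subDS-resp-∼ k T p) (subDS-resp-∼ k T q) ⟩
  dapDS (subDS k T S') (subDS k T U')     ≈⟨ ∼-perm (subDS-dapDS k T S' U') ⟨
  subDS k T (dapDS S' U')                 ∎
  where open ∼-Reasoning
subDS-resp-∼ k T (∼-sum {S} {S'} {U} {U'} p q) = begin
  subDS k T (S ++ U)                      ≡⟨ SubDS.extension-++ k T S U ⟩
  subDS k T S ++ subDS k T U              ≈⟨ ∼-sum (subDS-resp-∼ k T p) (subDS-resp-∼ k T q) ⟩
  subDS k T S' ++ subDS k T U'            ≡⟨ SubDS.extension-++ k T S' U' ⟨
  subDS k T (S' ++ U')                    ∎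
  where open ∼-Reasoning

dsubDS-resp-∼ : ∀ k T {S S'} → S ∼ S' → dsubDS k T S ∼ dsubDS k T S'
dsubDS-resp-∼ k T ∼-refl        = ∼-refl
dsubDS-resp-∼ k T (∼-sym p)     = ∼-sym (dsubDS-resp-∼ k T p)
dsubDS-resp-∼ k T (∼-trans p q) = ∼-trans (dsubDS-resp-∼ k T p) (dsubDS-resp-∼ k T q)
dsubDS-resp-∼ k T (∼-perm p)    = ∼-perm (DsubDS.extension-↭ k T p)
dsubDS-resp-∼ k T (∼-dswap {s} {t} {u}) = dsubDS-dswap k T s t u
dsubDS-resp-∼ k T (∼-lam {S} {S'} p) = begin
  dsubDS k T (map lam S)                       ≡⟨ dsubDS-map-lam k T S ⟩
  map lam (dsubDS (suc k) (shiftDS 0 T) S)     ≈⟨ ∼-lam (dsubDS-resp-∼ (suc k) (shiftDS 0 T) p) ⟩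
  map lam (dsubDS (suc k) (shiftDS 0 T) S')    ≡⟨ dsubDS-map-lam k T S' ⟨
  dsubDS k T (map lam S')                      ∎
  where open ∼-Reasoning
dsubDS-resp-∼ k T (∼-app {S} {S'} {U} {U'} p q) = begin
  dsubDS k T (appDS S U)
    ≈⟨ ∼-perm (dsubDS-appDS k T S U) ⟩
  appDS (dsubDS k T S) U ++ appDS (dapDS S (dsubDS k T U)) U
    ≈⟨ ∼-sum (∼-app (dsubDS-resp-∼ k T p) q) (∼-app (∼-dap p (dsubDS-resp-∼ k T q)) q) ⟩
  appDS (dsubDS k T S') U' ++ appDS (dapDS S' (dsubDS k T U')) U'
    ≈⟨ ∼-perm (dsubDS-appDS k T S' U') ⟨
  dsubDS k T (appDS S' U')
    ∎
  where open ∼-Reasoning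
dsubDS-resp-∼ k T (∼-dap {S} {S'} {U} {U'} p q) = begin
  dsubDS k T (dapDS S U)
    ≈⟨ ∼-perm (dsubDS-dapDS k T S U) ⟩
  dapDS (dsubDS k T S) U ++ dapDS S (dsubDS k T U)
    ≈⟨ ∼-sum (∼-dap (dsubDS-resp-∼ k T p) q) (∼-dap p (dsubDS-resp-∼ k T q)) ⟩
  dapDS (dsubDS k T S') U' ++ dapDS S' (dsubDS k T U')
    ≈⟨ ∼-perm (dsubDS-dapDS k T S' U') ⟨
  dsubDS k T (dapDS S' U')
    ∎
  where open ∼-Reasoning
dsubDS-resp-∼ k T (∼-sum {S} {S'} {U} {U'} p q) = begin
  dsubDS k T (S ++ U)                     ≡⟨ DsubDS.extension-++ k T S U ⟩
  dsubDS k T S ++ dsubDS k T U            ≈⟨ ∼-sum (dsubDS-resp-∼ k T p) (dsubDS-resp-∼ k T q) ⟩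
  dsubDS k T S' ++ dsubDS k T U'          ≡⟨ DsubDS.extension-++ k T S' U' ⟨
  dsubDS k T (S' ++ U')                   ∎
  where open ∼-Reasoning

DnΣ : DSum → List DSum → DSum
DnΣ S []       = S
DnΣ S (U ∷ Us) = DnΣ (dapDS S U) Us

DnS : DSum → List DTerm → DSum
DnS S ts = DnΣ S (map [_] ts)

DnΣ-resp-∼ : ∀ {S S'} Us → S ∼ S' → DnΣ S Us ∼ DnΣ S' Us
DnΣ-resp-∼ []       p = p
DnΣ-resp-∼ (U ∷ Us) p = DnΣ-resp-∼ Us (∼-dap p ∼-refl)

DnΣ-resp-≈d : ∀ {S S'} Us → S ≈d S' → DnΣ S Us ≈d DnΣ S' Us
DnΣ-resp-≈d []       p = p
DnΣ-resp-≈d (U ∷ Us) p = DnΣ-resp-≈d Us (d-dap p d-refl)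

DnS-map : ∀ S ts → DnS S ts ≡ map (λ s → Dn s ts) S
DnS-map S []       = ≡.sym (map-id S)
DnS-map S (t ∷ ts) = begin
  DnS (dapDS S [ t ]) ts                         ≡⟨ DnS-map (dapDS S [ t ]) ts ⟩
  map (λ s → Dn s ts) (dapDS S [ t ])            ≡⟨ cong (map (λ s → Dn s ts)) (dapDS-[-]ʳ S t) ⟩
  map (λ s → Dn s ts) (map (λ s → dap s t) S)    ≡⟨ map-∘ S ⟨
  map (λ s → Dn (dap s t) ts) S                  ∎
  where open ≡.≡-Reasoning

DnS-[-] : ∀ s ts → DnS [ s ] ts ≡ [ Dn s ts ]
DnS-[-] s ts = DnS-map [ s ] ts

DnS-++ : ∀ S S' ts → DnS (S ++ S') ts ≡ DnS S ts ++ DnS S' ts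
DnS-++ S S' ts = begin
  DnS (S ++ S') ts                                         ≡⟨ DnS-map (S ++ S') ts ⟩
  map (λ s → Dn s ts) (S ++ S')                            ≡⟨ map-++ (λ s → Dn s ts) S S' ⟩
  map (λ s → Dn s ts) S ++ map (λ s → Dn s ts) S'          ≡⟨ cong₂ _++_ (DnS-map S ts) (DnS-map S' ts) ⟨
  DnS S ts ++ DnS S' ts                                    ∎
  where open ≡.≡-Reasoning

Dn-resp-∼ : ∀ {s s'} ts → [ s ] ∼ [ s' ] → [ Dn s ts ] ∼ [ Dn s' ts ]
Dn-resp-∼ {s} {s'} ts p =
  ∼-trans (∼-reflexive (≡.sym (DnS-[-] s ts)))
          (∼-trans (DnΣ-resp-∼ (map [_] ts) p) (∼-reflexive (DnS-[-] s' ts)))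

Dn-↭ : ∀ s {ts ts'} → ts ↭ ts' → [ Dn s ts ] ∼ [ Dn s ts' ]
Dn-↭ s refl                   = ∼-refl
Dn-↭ s (prep t p)             = Dn-↭ (dap s t) p
Dn-↭ s (swap {xs = ts} t u p) = ∼-trans (Dn-resp-∼ ts ∼-dswap) (Dn-↭ (dap (dap s u) t) p)
Dn-↭ s (trans p q)            = ∼-trans (Dn-↭ s p) (Dn-↭ s q)

DnS-dapDS : ∀ s X ts → DnS (dapDS [ s ] X) ts ∼ dapDS [ Dn s ts ] X
DnS-dapDS s X []       = ∼-refl
DnS-dapDS s X (t ∷ ts) =
  ∼-trans (DnΣ-resp-∼ (map [_] ts) (dapDS-swap [ s ] X [ t ])) (DnS-dapDS (dap s t) X ts)

module _ (k : ℕ) (T : DSum) where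

  -- dsubD-Dn is the clause for ∂(Dⁿ s·(t₁…tₙ))/∂x·T, which dsubD states only for
  -- n = 1; dsubArgs collects the summands that differentiate some tᵢ.
  dsubArgs : DTerm → List DTerm → DSum
  dsubArgs s []       = []
  dsubArgs s (t ∷ ts) = DnS (dapDS [ s ] (dsubD k T t)) ts ++ dsubArgs (dap s t) ts

  dsubD-Dn : ∀ s ts → dsubD k T (Dn s ts) ≡ DnS (dsubD k T s) ts ++ dsubArgs s ts
  dsubD-Dn s []       = ≡.sym (++-identityʳ _)
  dsubD-Dn s (t ∷ ts) = begin
    dsubD k T (Dn (dap s t) ts)
      ≡⟨ dsubD-Dn (dap s t) ts ⟩
    DnS (dapDS (dsubD k T s) [ t ] ++ dapDS [ s ] (dsubD k T t)) ts ++ dsubArgs (dap s t) ts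
      ≡⟨ cong (_++ dsubArgs (dap s t) ts) (DnS-++ (dapDS (dsubD k T s) [ t ]) (dapDS [ s ] (dsubD k T t)) ts) ⟩
    (DnS (dapDS (dsubD k T s) [ t ]) ts ++ DnS (dapDS [ s ] (dsubD k T t)) ts) ++ dsubArgs (dap s t) ts
      ≡⟨ ++-assoc (DnS (dapDS (dsubD k T s) [ t ]) ts) _ _ ⟩
    DnS (dsubD k T s) (t ∷ ts) ++ dsubArgs s (t ∷ ts)
      ∎
    where open ≡.≡-Reasoning

  subD-Dn : ∀ s ts → subD k T (Dn s ts) ≡ DnΣ (subD k T s) (map (subD k T) ts)
  subD-Dn s []       = refl
  subD-Dn s (t ∷ ts) = subD-Dn (dap s t) ts

dsubD-app-Dn : ∀ k T s ts U → dsubD k T (app (Dn s ts) U) ≡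
               appDS (DnS (dsubD k T s) ts) U ++
               (appDS (dsubArgs k T s ts) U ++ appDS (dapDS [ Dn s ts ] (dsubDS k T U)) U)
dsubD-app-Dn k T s ts U = begin
  appDS (dsubD k T (Dn s ts)) U ++ ∂U
    ≡⟨ cong (λ S → appDS S U ++ ∂U) (dsubD-Dn k T s ts) ⟩
  appDS (DnS (dsubD k T s) ts ++ dsubArgs k T s ts) U ++ ∂U
    ≡⟨ cong (_++ ∂U) (appDS-++ (DnS (dsubD k T s) ts) (dsubArgs k T s ts) U) ⟩
  (appDS (DnS (dsubD k T s) ts) U ++ appDS (dsubArgs k T s ts) U) ++ ∂U
    ≡⟨ ++-assoc (appDS (DnS (dsubD k T s) ts) U) _ _ ⟩
  appDS (DnS (dsubD k T s) ts) U ++ (appDS (dsubArgs k T s ts) U ++ ∂U)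
    ∎
  where
  open ≡.≡-Reasoning
  ∂U = appDS (dapDS [ Dn s ts ] (dsubDS k T U)) U

dsubsD : ℕ → List DTerm → DSum → DSum
dsubsD k []       S = S
dsubsD k (t ∷ ts) S = dsubsD k ts (dsubDS k [ t ] S)

dsubsD-resp-∼ : ∀ k ts {S S'} → S ∼ S' → dsubsD k ts S ∼ dsubsD k ts S'
dsubsD-resp-∼ k []       p = p
dsubsD-resp-∼ k (t ∷ ts) p = dsubsD-resp-∼ k ts (dsubDS-resp-∼ k [ t ] p)

dapDS-map-lam-β : ∀ S t → dapDS (map lam S) [ t ] ≈d map lam (dsubDS 0 [ shiftD 0 t ] S)
dapDS-map-lam-β S t = begin
  dapDS (map lam S) [ t ]
    ≡⟨ dapDS-mapˡ lam S [ t ] ⟩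
  concatMap (λ s → [ dap (lam s) t ]) S
    ≈⟨ concatMap-cong-≈d (λ s → d-dbeta s t) S ⟩
  concatMap (λ s → map lam (dsubD 0 [ shiftD 0 t ] s)) S
    ≡⟨ map-concatMap lam (dsubD 0 [ shiftD 0 t ]) S ⟨
  map lam (concatMap (dsubD 0 [ shiftD 0 t ]) S)
    ≡⟨ cong (map lam) (DsubDS.extension-concatMap 0 [ shiftD 0 t ] S) ⟨
  map lam (dsubDS 0 [ shiftD 0 t ] S)
    ∎
  where open ≈d-Reasoning

DnS-map-lam-β : ∀ S ts → DnS (map lam S) ts ≈d map lam (dsubsD 0 (map (shiftD 0) ts) S)
DnS-map-lam-β S []       = d-refl
DnS-map-lam-β S (t ∷ ts) =
  d-trans (DnΣ-resp-≈d (map [_] ts) (dapDS-map-lam-β S t)) (DnS-map-lam-β (dsubDS 0 [ shiftD 0 t ] S) ts)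

appDS-map-lam-β : ∀ S U → appDS (map lam S) U ≈d subDS 0 U S
appDS-map-lam-β S U = begin
  appDS (map lam S) U                     ≡⟨ map-∘ S ⟨
  map (λ s → app (lam s) U) S             ≡⟨ map-as-concatMap (λ s → app (lam s) U) S ⟩
  concatMap (λ s → [ app (lam s) U ]) S   ≈⟨ concatMap-cong-≈d (λ s → d-beta s U) S ⟩
  concatMap (subD 0 U) S                  ≡⟨ SubDS.extension-concatMap 0 U S ⟨
  subDS 0 U S                             ∎
  where open ≈d-Reasoning

shiftD-Dn : ∀ c s ts → shiftD c (Dn s ts) ≡ Dn (shiftD c s) (map (shiftD c) ts)
shiftD-Dn c s []       = refl
shiftD-Dn c s (t ∷ ts) = shiftD-Dn c (dap s t) ts

shiftDS-map : ∀ c S → shiftDS c S ≡ map (shiftD c) S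
shiftDS-map c []      = refl
shiftDS-map c (t ∷ S) = cong (shiftD c t ∷_) (shiftDS-map c S)

mutual
  shiftR-ᵈ : ∀ c M → shiftR c M ᵈ ≡ shiftD c (M ᵈ)
  shiftR-ᵈ c (var j)   = refl
  shiftR-ᵈ c (lam M)   = cong lam (shiftR-ᵈ (suc c) M)
  shiftR-ᵈ c (app M P) = begin
    app (Dn (shiftR c M ᵈ) (linsᵈ (shiftB c P))) (bangsᵈ (shiftB c P))
      ≡⟨ cong₂ (λ s ts → app (Dn s ts) (bangsᵈ (shiftB c P))) (shiftR-ᵈ c M) (linsᵈ-shiftB c P) ⟩
    app (Dn (shiftD c (M ᵈ)) (map (shiftD c) (linsᵈ P))) (bangsᵈ (shiftB c P))
      ≡⟨ cong₂ app (≡.sym (shiftD-Dn c (M ᵈ) (linsᵈ P))) (bangsᵈ-shiftB c P) ⟩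
    shiftD c (app M P ᵈ)
      ∎
    where open ≡.≡-Reasoning

  linsᵈ-shiftB : ∀ c P → linsᵈ (shiftB c P) ≡ map (shiftD c) (linsᵈ P)
  linsᵈ-shiftB c []           = refl
  linsᵈ-shiftB c (lin M ∷ P)  = cong₂ _∷_ (shiftR-ᵈ c M) (linsᵈ-shiftB c P)
  linsᵈ-shiftB c (bang M ∷ P) = linsᵈ-shiftB c P

  bangsᵈ-shiftB : ∀ c P → bangsᵈ (shiftB c P) ≡ shiftDS c (bangsᵈ P)
  bangsᵈ-shiftB c []           = refl
  bangsᵈ-shiftB c (lin M ∷ P)  = bangsᵈ-shiftB c P
  bangsᵈ-shiftB c (bang M ∷ P) = cong₂ _∷_ (shiftR-ᵈ c M) (bangsᵈ-shiftB c P)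

map-shiftR-ᵈˢ : ∀ c N → map (shiftR c) N ᵈˢ ≡ shiftDS c (N ᵈˢ)
map-shiftR-ᵈˢ c []      = refl
map-shiftR-ᵈˢ c (M ∷ N) = cong₂ _∷_ (shiftR-ᵈ c M) (map-shiftR-ᵈˢ c N)

-- (s P)ᵈ for an already translated head s, with the translations B of further
-- reusable resources added to the bag; (M P)ᵈ is appBagᵈ (M ᵈ) [] P.
appBagᵈ : DTerm → DSum → Bag → DTerm
appBagᵈ s B P = app (Dn s (linsᵈ P)) (B ++ bangsᵈ P)

appBagsᵈ : DSum → DSum → BSum → DSum
appBagsᵈ S B Ps = concatMap (λ s → map (appBagᵈ s B) Ps) S

appS-ᵈ : ∀ Ms Ps → appS Ms Ps ᵈˢ ≡ appBagsᵈ (Ms ᵈˢ) [] Ps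
appS-ᵈ Ms Ps = begin
  map _ᵈ (concatMap (λ M → map (app M) Ps) Ms)          ≡⟨ map-concatMap _ᵈ (λ M → map (app M) Ps) Ms ⟩
  concatMap (λ M → map _ᵈ (map (app M) Ps)) Ms          ≡⟨ concatMap-cong (λ M → map-∘ Ps) Ms ⟨
  concatMap (λ M → map (appBagᵈ (M ᵈ) []) Ps) Ms        ≡⟨ concatMap-map (λ s → map (appBagᵈ s []) Ps) _ᵈ Ms ⟨
  appBagsᵈ (Ms ᵈˢ) [] Ps                                ∎
  where open ≡.≡-Reasoning

lamS-ᵈ : ∀ Ms → lamS Ms ᵈˢ ≡ map lam (Ms ᵈˢ)
lamS-ᵈ []       = refl
lamS-ᵈ (M ∷ Ms) = cong (lam (M ᵈ) ∷_) (lamS-ᵈ Ms)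

map-appBagᵈ : ∀ S B P → map (λ s → appBagᵈ s B P) S ≡ appDS (DnS S (linsᵈ P)) (B ++ bangsᵈ P)
map-appBagᵈ S B P = begin
  map (λ s → appBagᵈ s B P) S
    ≡⟨ map-∘ S ⟩
  appDS (map (λ s → Dn s (linsᵈ P)) S) (B ++ bangsᵈ P)
    ≡⟨ cong (λ S' → appDS S' (B ++ bangsᵈ P)) (DnS-map S (linsᵈ P)) ⟨
  appDS (DnS S (linsᵈ P)) (B ++ bangsᵈ P)
    ∎
  where open ≡.≡-Reasoning

appBagsᵈ-[-] : ∀ S B P → appBagsᵈ S B [ P ] ≡ appDS (DnS S (linsᵈ P)) (B ++ bangsᵈ P)
appBagsᵈ-[-] S B P = ≡.trans (≡.sym (map-as-concatMap (λ s → appBagᵈ s B P) S)) (map-appBagᵈ S B P)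

appBagsᵈ-comm-↭ : ∀ S B Ps →
                  appBagsᵈ S B Ps ↭ concatMap (λ P → appDS (DnS S (linsᵈ P)) (B ++ bangsᵈ P)) Ps
appBagsᵈ-comm-↭ S B Ps = begin
  concatMap (λ s → map (appBagᵈ s B) Ps) S
    ≡⟨ concatMap-cong (λ s → map-as-concatMap (appBagᵈ s B) Ps) S ⟩
  concatMap (λ s → concatMap (λ P → [ appBagᵈ s B P ]) Ps) S
    ↭⟨ concatMap-comm-↭ (λ s P → [ appBagᵈ s B P ]) S Ps ⟩
  concatMap (λ P → concatMap (λ s → [ appBagᵈ s B P ]) S) Ps
    ≡⟨ concatMap-cong (λ P → appBagsᵈ-[-] S B P) Ps ⟩
  concatMap (λ P → appDS (DnS S (linsᵈ P)) (B ++ bangsᵈ P)) Ps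
    ∎
  where open PermutationReasoning

appBagsᵈ-congˡ : ∀ {S S'} B Ps → S ≈d S' → appBagsᵈ S B Ps ≈d appBagsᵈ S' B Ps
appBagsᵈ-congˡ {S} {S'} B Ps p = begin
  appBagsᵈ S B Ps                                                ≈⟨ d-perm (appBagsᵈ-comm-↭ S B Ps) ⟩
  concatMap (λ P → appDS (DnS S (linsᵈ P)) (B ++ bangsᵈ P)) Ps   ≈⟨ concatMap-cong-≈d heads Ps ⟩
  concatMap (λ P → appDS (DnS S' (linsᵈ P)) (B ++ bangsᵈ P)) Ps  ≈⟨ d-perm (appBagsᵈ-comm-↭ S' B Ps) ⟨
  appBagsᵈ S' B Ps                                               ∎
  where
  open ≈d-Reasoning
  heads : ∀ P → appDS (DnS S (linsᵈ P)) (B ++ bangsᵈ P) ≈d appDS (DnS S' (linsᵈ P)) (B ++ bangsᵈ P)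
  heads P = d-app (DnΣ-resp-≈d (map [_] (linsᵈ P)) p) d-refl

map-appBagᵈ-congʳ : ∀ s {B B'} Ps → B ≈d B' → map (appBagᵈ s B) Ps ≈d map (appBagᵈ s B') Ps
map-appBagᵈ-congʳ s []       p = d-refl
map-appBagᵈ-congʳ s (P ∷ Ps) p =
  d-sum (d-app (d-refl {[ Dn s (linsᵈ P) ]}) (d-sum p (d-refl {bangsᵈ P}))) (map-appBagᵈ-congʳ s Ps p)

appBagᵈ-bang : ∀ s B M P → appBagᵈ s B (bang M ∷ P) ≡ appBagᵈ s (B ++ [ M ᵈ ]) P
appBagᵈ-bang s B M P = cong (app (Dn s (linsᵈ P))) (≡.sym (++-assoc B [ M ᵈ ] (bangsᵈ P)))

appBagᵈ-bangs : ∀ s B Ms P → appBagᵈ s B (map bang Ms ++ P) ≡ appBagᵈ s (B ++ Ms ᵈˢ) P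
appBagᵈ-bangs s B []       P = cong (λ B' → app (Dn s (linsᵈ P)) (B' ++ bangsᵈ P)) (≡.sym (++-identityʳ B))
appBagᵈ-bangs s B (M ∷ Ms) P = begin
  appBagᵈ s B (bang M ∷ map bang Ms ++ P)     ≡⟨ appBagᵈ-bang s B M (map bang Ms ++ P) ⟩
  appBagᵈ s (B ++ [ M ᵈ ]) (map bang Ms ++ P) ≡⟨ appBagᵈ-bangs s (B ++ [ M ᵈ ]) Ms P ⟩
  appBagᵈ s ((B ++ [ M ᵈ ]) ++ Ms ᵈˢ) P       ≡⟨ cong (λ B' → appBagᵈ s B' P) (++-assoc B [ M ᵈ ] (Ms ᵈˢ)) ⟩
  appBagᵈ s (B ++ (M ∷ Ms) ᵈˢ) P              ∎
  where open ≡.≡-Reasoning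

map-appBagᵈ-consBang : ∀ s B Ms Ps →
                       map (appBagᵈ s B) (consBang Ms Ps) ≡ map (appBagᵈ s (B ++ Ms ᵈˢ)) Ps
map-appBagᵈ-consBang s B Ms Ps = ≡.trans (≡.sym (map-∘ Ps)) (map-cong (appBagᵈ-bangs s B Ms) Ps)

appBagsᵈ-consBang : ∀ S B Ms Ps → appBagsᵈ S B (consBang Ms Ps) ≡ appBagsᵈ S (B ++ Ms ᵈˢ) Ps
appBagsᵈ-consBang S B Ms Ps = concatMap-cong (λ s → map-appBagᵈ-consBang s B Ms Ps) S

appBagsᵈ-consLin : ∀ S B Ms Ps → appBagsᵈ S B (consLin Ms Ps) ≡ appBagsᵈ (dapDS S (Ms ᵈˢ)) B Ps
appBagsᵈ-consLin S B Ms Ps = begin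
  concatMap (λ s → map (appBagᵈ s B) (concatMap (λ M → map (lin M ∷_) Ps) Ms)) S
    ≡⟨ concatMap-cong (λ s → map-concatMap (appBagᵈ s B) (λ M → map (lin M ∷_) Ps) Ms) S ⟩
  concatMap (λ s → concatMap (λ M → map (appBagᵈ s B) (map (lin M ∷_) Ps)) Ms) S
    ≡⟨ concatMap-cong (λ s → concatMap-cong (λ M → map-∘ Ps) Ms) S ⟨
  concatMap (λ s → concatMap (λ M → map (appBagᵈ (dap s (M ᵈ)) B) Ps) Ms) S
    ≡⟨ concatMap-cong (λ s → concatMap-map (λ t → map (appBagᵈ (dap s t) B) Ps) _ᵈ Ms) S ⟨
  concatMap (λ s → concatMap (λ t → map (appBagᵈ (dap s t) B) Ps) (Ms ᵈˢ)) S
    ≡⟨ concatMap-cong (λ s → concatMap-map (λ s' → map (appBagᵈ s' B) Ps) (dap s) (Ms ᵈˢ)) S ⟨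
  concatMap (λ s → concatMap (λ s' → map (appBagᵈ s' B) Ps) (map (dap s) (Ms ᵈˢ))) S
    ≡⟨ concatMap-concatMap (λ s' → map (appBagᵈ s' B) Ps) (λ s → map (dap s) (Ms ᵈˢ)) S ⟨
  appBagsᵈ (dapDS S (Ms ᵈˢ)) B Ps
    ∎
  where open ≡.≡-Reasoning

map-appBagᵈ-consLin : ∀ s B Ms P →
                      map (appBagᵈ s B) (consLin Ms [ P ]) ≡
                      appDS (DnS (dapDS [ s ] (Ms ᵈˢ)) (linsᵈ P)) (B ++ bangsᵈ P)
map-appBagᵈ-consLin s B Ms P = begin
  map (appBagᵈ s B) (consLin Ms [ P ])      ≡⟨ ++-identityʳ _ ⟨
  appBagsᵈ [ s ] B (consLin Ms [ P ])       ≡⟨ appBagsᵈ-consLin [ s ] B Ms [ P ] ⟩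
  appBagsᵈ (dapDS [ s ] (Ms ᵈˢ)) B [ P ]    ≡⟨ appBagsᵈ-[-] (dapDS [ s ] (Ms ᵈˢ)) B P ⟩
  appDS (DnS (dapDS [ s ] (Ms ᵈˢ)) (linsᵈ P)) (B ++ bangsᵈ P)
                                            ∎
  where open ≡.≡-Reasoning

-- The summands of ∂(appBagᵈ s B P)/∂x·T that differentiate a resource of P
-- rather than the head s.
dsubBagᵈ : ℕ → DSum → DTerm → DSum → Bag → DSum
dsubBagᵈ k T s B P =
  appDS (dsubArgs k T s (linsᵈ P)) (B ++ bangsᵈ P) ++
  appDS (dapDS [ Dn s (linsᵈ P) ] (dsubDS k T (bangsᵈ P))) (B ++ bangsᵈ P)

mutual
  lsubᵈ : ∀ k L M → lsub k L M ᵈˢ ∼ dsubD k [ L ᵈ ] (M ᵈ)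
  lsubᵈ k L (var j) with j ≡ᵇ k
  ... | true  = ∼-refl
  ... | false = ∼-refl
  lsubᵈ k L (lam M) = begin
    lamS (lsub (suc k) (shiftR 0 L) M) ᵈˢ
      ≡⟨ lamS-ᵈ (lsub (suc k) (shiftR 0 L) M) ⟩
    map lam (lsub (suc k) (shiftR 0 L) M ᵈˢ)
      ≈⟨ ∼-lam (lsubᵈ (suc k) (shiftR 0 L) M) ⟩
    map lam (dsubD (suc k) [ shiftR 0 L ᵈ ] (M ᵈ))
      ≡⟨ cong (λ t → map lam (dsubD (suc k) [ t ] (M ᵈ))) (shiftR-ᵈ 0 L) ⟩
    dsubD k [ L ᵈ ] (lam M ᵈ)
      ∎
    where open ∼-Reasoning
  lsubᵈ k L (app M P) = begin
    map _ᵈ (appS (lsub k L M) [ P ] ++ appS [ M ] (lsubB k L P))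
      ≡⟨ map-++ _ᵈ (appS (lsub k L M) [ P ]) (appS [ M ] (lsubB k L P)) ⟩
    appS (lsub k L M) [ P ] ᵈˢ ++ appS [ M ] (lsubB k L P) ᵈˢ
      ≈⟨ ∼-sum head bag ⟩
    appDS (DnS (dsubD k T (M ᵈ)) (linsᵈ P)) (bangsᵈ P) ++ dsubBagᵈ k T (M ᵈ) [] P
      ≡⟨ dsubD-app-Dn k T (M ᵈ) (linsᵈ P) (bangsᵈ P) ⟨
    dsubD k T (app M P ᵈ)
      ∎
    where
    open ∼-Reasoning
    T = [ L ᵈ ]
    head : appS (lsub k L M) [ P ] ᵈˢ ∼ appDS (DnS (dsubD k T (M ᵈ)) (linsᵈ P)) (bangsᵈ P)
    head = begin
      appS (lsub k L M) [ P ] ᵈˢ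
        ≡⟨ ≡.trans (appS-ᵈ (lsub k L M) [ P ]) (appBagsᵈ-[-] (lsub k L M ᵈˢ) [] P) ⟩
      appDS (DnS (lsub k L M ᵈˢ) (linsᵈ P)) (bangsᵈ P)
        ≈⟨ ∼-app (DnΣ-resp-∼ (map [_] (linsᵈ P)) (lsubᵈ k L M)) ∼-refl ⟩
      appDS (DnS (dsubD k T (M ᵈ)) (linsᵈ P)) (bangsᵈ P)
        ∎
    bag : appS [ M ] (lsubB k L P) ᵈˢ ∼ dsubBagᵈ k T (M ᵈ) [] P
    bag = ∼-trans (∼-reflexive (≡.trans (appS-ᵈ [ M ] (lsubB k L P)) (++-identityʳ _)))
                  (lsubBᵈ k L (M ᵈ) [] P)

  lsubBᵈ : ∀ k L s B P → map (appBagᵈ s B) (lsubB k L P) ∼ dsubBagᵈ k [ L ᵈ ] s B P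
  lsubBᵈ k L s B [] = ∼-refl
  lsubBᵈ k L s B (lin M ∷ P) = begin
    map (appBagᵈ s B) (consLin (lsub k L M) [ P ] ++ map (lin M ∷_) (lsubB k L P))
      ≡⟨ map-++ (appBagᵈ s B) (consLin (lsub k L M) [ P ]) (map (lin M ∷_) (lsubB k L P)) ⟩
    map (appBagᵈ s B) (consLin (lsub k L M) [ P ]) ++ map (appBagᵈ s B) (map (lin M ∷_) (lsubB k L P))
      ≈⟨ ∼-sum argument rest ⟩
    appDS (DnS (dapDS [ s ] ∂M) ls) U ++ (appDS (dsubArgs k T (dap s (M ᵈ)) ls) U ++ ∂Bs)
      ≡⟨ ++-assoc (appDS (DnS (dapDS [ s ] ∂M) ls) U) _ _ ⟨
    (appDS (DnS (dapDS [ s ] ∂M) ls) U ++ appDS (dsubArgs k T (dap s (M ᵈ)) ls) U) ++ ∂Bs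
      ≡⟨ cong (_++ ∂Bs) (appDS-++ (DnS (dapDS [ s ] ∂M) ls) (dsubArgs k T (dap s (M ᵈ)) ls) U) ⟨
    dsubBagᵈ k T s B (lin M ∷ P)
      ∎
    where
    open ∼-Reasoning
    T = [ L ᵈ ]
    ls = linsᵈ P
    U = B ++ bangsᵈ P
    ∂M = dsubD k T (M ᵈ)
    ∂Bs = appDS (dapDS [ Dn (dap s (M ᵈ)) ls ] (dsubDS k T (bangsᵈ P))) U
    argument : map (appBagᵈ s B) (consLin (lsub k L M) [ P ]) ∼ appDS (DnS (dapDS [ s ] ∂M) ls) U
    argument = ∼-trans (∼-reflexive (map-appBagᵈ-consLin s B (lsub k L M) P))
                       (∼-app (DnΣ-resp-∼ (map [_] ls) (∼-dap (∼-refl {[ s ]}) (lsubᵈ k L M))) ∼-refl)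
    rest : map (appBagᵈ s B) (map (lin M ∷_) (lsubB k L P)) ∼ dsubBagᵈ k T (dap s (M ᵈ)) B P
    rest = ∼-trans (∼-reflexive (≡.sym (map-∘ (lsubB k L P)))) (lsubBᵈ k L (dap s (M ᵈ)) B P)
  lsubBᵈ k L s B (bang M ∷ P) = begin
    map (appBagᵈ s B) (consLin (lsub k L M) [ bang M ∷ P ] ++ map (bang M ∷_) (lsubB k L P))
      ≡⟨ map-++ (appBagᵈ s B) (consLin (lsub k L M) [ bang M ∷ P ]) (map (bang M ∷_) (lsubB k L P)) ⟩
    map (appBagᵈ s B) (consLin (lsub k L M) [ bang M ∷ P ]) ++ map (appBagᵈ s B) (map (bang M ∷_) (lsubB k L P))
      ≈⟨ ∼-sum argument rest ⟩
    appDS (dapDS [ Dn s ls ] ∂M) U ++ (appDS (dsubArgs k T s ls) U ++ appDS (dapDS [ Dn s ls ] ∂Bs) U)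
      ≈⟨ ∼-perm (shifts (appDS (dapDS [ Dn s ls ] ∂M) U) (appDS (dsubArgs k T s ls) U)) ⟩
    appDS (dsubArgs k T s ls) U ++ (appDS (dapDS [ Dn s ls ] ∂M) U ++ appDS (dapDS [ Dn s ls ] ∂Bs) U)
      ≡⟨ cong (appDS (dsubArgs k T s ls) U ++_) split ⟨
    dsubBagᵈ k T s B (bang M ∷ P)
      ∎
    where
    open ∼-Reasoning
    T = [ L ᵈ ]
    ls = linsᵈ P
    U = B ++ (M ᵈ ∷ bangsᵈ P)
    ∂M = dsubD k T (M ᵈ)
    ∂Bs = dsubDS k T (bangsᵈ P)
    argument : map (appBagᵈ s B) (consLin (lsub k L M) [ bang M ∷ P ]) ∼ appDS (dapDS [ Dn s ls ] ∂M) U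
    argument = ∼-trans (∼-reflexive (map-appBagᵈ-consLin s B (lsub k L M) (bang M ∷ P)))
                       (∼-app (∼-trans (DnΣ-resp-∼ (map [_] ls) (∼-dap (∼-refl {[ s ]}) (lsubᵈ k L M)))
                                       (DnS-dapDS s ∂M ls))
                              ∼-refl)
    rest : map (appBagᵈ s B) (map (bang M ∷_) (lsubB k L P)) ∼
           appDS (dsubArgs k T s ls) U ++ appDS (dapDS [ Dn s ls ] ∂Bs) U
    rest = begin
      map (appBagᵈ s B) (map (bang M ∷_) (lsubB k L P))
        ≡⟨ ≡.trans (≡.sym (map-∘ (lsubB k L P))) (map-cong (appBagᵈ-bang s B M) (lsubB k L P)) ⟩
      map (appBagᵈ s (B ++ [ M ᵈ ])) (lsubB k L P)
        ≈⟨ lsubBᵈ k L s (B ++ [ M ᵈ ]) P ⟩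
      dsubBagᵈ k T s (B ++ [ M ᵈ ]) P
        ≡⟨ cong (λ U' → appDS (dsubArgs k T s ls) U' ++ appDS (dapDS [ Dn s ls ] ∂Bs) U')
                (++-assoc B [ M ᵈ ] (bangsᵈ P)) ⟩
      appDS (dsubArgs k T s ls) U ++ appDS (dapDS [ Dn s ls ] ∂Bs) U
        ∎
    split : appDS (dapDS [ Dn s ls ] (∂M ++ ∂Bs)) U ≡
            appDS (dapDS [ Dn s ls ] ∂M) U ++ appDS (dapDS [ Dn s ls ] ∂Bs) U
    split = ≡.trans (cong (λ S → appDS S U) (dapDS-[-]-++ʳ (Dn s ls) ∂M ∂Bs))
                    (appDS-++ (dapDS [ Dn s ls ] ∂M) (dapDS [ Dn s ls ] ∂Bs) U)

mutual
  rsubᵈ : ∀ k N M → rsub k N M ᵈˢ ∼ subD k (N ᵈˢ) (M ᵈ)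
  rsubᵈ k N (var j) with j <ᵇ k
  ... | true = ∼-refl
  ... | false with j ≡ᵇ k
  ...   | true  = ∼-refl
  ...   | false = ∼-refl
  rsubᵈ k N (lam M) = begin
    lamS (rsub (suc k) N' M) ᵈˢ            ≡⟨ lamS-ᵈ (rsub (suc k) N' M) ⟩
    map lam (rsub (suc k) N' M ᵈˢ)          ≈⟨ ∼-lam (rsubᵈ (suc k) N' M) ⟩
    map lam (subD (suc k) (N' ᵈˢ) (M ᵈ))   ≡⟨ cong (λ T → map lam (subD (suc k) T (M ᵈ))) (map-shiftR-ᵈˢ 0 N) ⟩
    subD k (N ᵈˢ) (lam M ᵈ)                ∎
    where
    open ∼-Reasoning
    N' = map (shiftR 0) N
  rsubᵈ k N (app M P) = begin
    appS (rsub k N M) (bsub k N P) ᵈˢ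
      ≡⟨ appS-ᵈ (rsub k N M) (bsub k N P) ⟩
    appBagsᵈ (rsub k N M ᵈˢ) [] (bsub k N P)
      ≈⟨ bsubᵈ k N (rsub k N M ᵈˢ) [] P ⟩
    appDS (DnΣ (rsub k N M ᵈˢ) subs) (subDS k Nᵈ (bangsᵈ P))
      ≈⟨ ∼-app (DnΣ-resp-∼ subs (rsubᵈ k N M)) ∼-refl ⟩
    appDS (DnΣ (subD k Nᵈ (M ᵈ)) subs) (subDS k Nᵈ (bangsᵈ P))
      ≡⟨ cong (λ S → appDS S (subDS k Nᵈ (bangsᵈ P))) (subD-Dn k Nᵈ (M ᵈ) (linsᵈ P)) ⟨
    subD k Nᵈ (app M P ᵈ)
      ∎
    where
    open ∼-Reasoning
    Nᵈ = N ᵈˢ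
    subs = map (subD k Nᵈ) (linsᵈ P)

  bsubᵈ : ∀ k N S B P → appBagsᵈ S B (bsub k N P) ∼
          appDS (DnΣ S (map (subD k (N ᵈˢ)) (linsᵈ P))) (B ++ subDS k (N ᵈˢ) (bangsᵈ P))
  bsubᵈ k N S B [] = ∼-reflexive (appBagsᵈ-[-] S B [])
  bsubᵈ k N S B (lin M ∷ P) = begin
    appBagsᵈ S B (consLin (rsub k N M) (bsub k N P))
      ≡⟨ appBagsᵈ-consLin S B (rsub k N M) (bsub k N P) ⟩
    appBagsᵈ (dapDS S (rsub k N M ᵈˢ)) B (bsub k N P)
      ≈⟨ bsubᵈ k N (dapDS S (rsub k N M ᵈˢ)) B P ⟩
    appDS (DnΣ (dapDS S (rsub k N M ᵈˢ)) subs) U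
      ≈⟨ ∼-app (DnΣ-resp-∼ subs (∼-dap (∼-refl {S}) (rsubᵈ k N M))) ∼-refl ⟩
    appDS (DnΣ (dapDS S (subD k (N ᵈˢ) (M ᵈ))) subs) U
      ∎
    where
    open ∼-Reasoning
    subs = map (subD k (N ᵈˢ)) (linsᵈ P)
    U = B ++ subDS k (N ᵈˢ) (bangsᵈ P)
  bsubᵈ k N S B (bang M ∷ P) = begin
    appBagsᵈ S B (consBang (rsub k N M) (bsub k N P))
      ≡⟨ appBagsᵈ-consBang S B (rsub k N M) (bsub k N P) ⟩
    appBagsᵈ S (B ++ rsub k N M ᵈˢ) (bsub k N P)
      ≈⟨ bsubᵈ k N S (B ++ rsub k N M ᵈˢ) P ⟩
    appDS (DnΣ S subs) ((B ++ rsub k N M ᵈˢ) ++ Bs)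
      ≡⟨ cong (appDS (DnΣ S subs)) (++-assoc B (rsub k N M ᵈˢ) Bs) ⟩
    appDS (DnΣ S subs) (B ++ (rsub k N M ᵈˢ ++ Bs))
      ≈⟨ ∼-app ∼-refl (∼-sum (∼-refl {B}) (∼-sum (rsubᵈ k N M) ∼-refl)) ⟩
    appDS (DnΣ S subs) (B ++ (subD k (N ᵈˢ) (M ᵈ) ++ Bs))
      ∎
    where
    open ∼-Reasoning
    subs = map (subD k (N ᵈˢ)) (linsᵈ P)
    Bs = subDS k (N ᵈˢ) (bangsᵈ P)

rsubSᵈ : ∀ k N Ms → rsubS k N Ms ᵈˢ ∼ subDS k (N ᵈˢ) (Ms ᵈˢ)
rsubSᵈ k N Ms = begin
  map _ᵈ (concatMap (rsub k N) Ms)          ≡⟨ map-concatMap _ᵈ (rsub k N) Ms ⟩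
  concatMap (λ M → rsub k N M ᵈˢ) Ms        ≈⟨ concatMap-cong-∼ (rsubᵈ k N) Ms ⟩
  concatMap (λ M → subD k (N ᵈˢ) (M ᵈ)) Ms  ≡⟨ concatMap-map (subD k (N ᵈˢ)) _ᵈ Ms ⟨
  concatMap (subD k (N ᵈˢ)) (Ms ᵈˢ)         ≡⟨ SubDS.extension-concatMap k (N ᵈˢ) (Ms ᵈˢ) ⟨
  subDS k (N ᵈˢ) (Ms ᵈˢ)                    ∎
  where open ∼-Reasoning

lsubSᵈ : ∀ k L Ms → lsubS k L Ms ᵈˢ ∼ dsubDS k [ L ᵈ ] (Ms ᵈˢ)
lsubSᵈ k L Ms = begin
  map _ᵈ (concatMap (lsub k L) Ms)          ≡⟨ map-concatMap _ᵈ (lsub k L) Ms ⟩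
  concatMap (λ M → lsub k L M ᵈˢ) Ms        ≈⟨ concatMap-cong-∼ (lsubᵈ k L) Ms ⟩
  concatMap (λ M → dsubD k [ L ᵈ ] (M ᵈ)) Ms ≡⟨ concatMap-map (dsubD k [ L ᵈ ]) _ᵈ Ms ⟨
  concatMap (dsubD k [ L ᵈ ]) (Ms ᵈˢ)       ≡⟨ DsubDS.extension-concatMap k [ L ᵈ ] (Ms ᵈˢ) ⟨
  dsubDS k [ L ᵈ ] (Ms ᵈˢ)                  ∎
  where open ∼-Reasoning

lsubsᵈ : ∀ k Ls Ms → lsubs k Ls Ms ᵈˢ ∼ dsubsD k (Ls ᵈˢ) (Ms ᵈˢ)
lsubsᵈ k []       Ms = ∼-refl
lsubsᵈ k (L ∷ Ls) Ms = ∼-trans (lsubsᵈ k Ls (lsubS k L Ms)) (dsubsD-resp-∼ k (Ls ᵈˢ) (lsubSᵈ k L Ms))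

linᵈ? : Res → Maybe DTerm
linᵈ? (lin M)  = just (M ᵈ)
linᵈ? (bang M) = nothing

bangᵈ? : Res → Maybe DTerm
bangᵈ? (lin M)  = nothing
bangᵈ? (bang M) = just (M ᵈ)

linsᵈ-mapMaybe : ∀ P → linsᵈ P ≡ mapMaybe linᵈ? P
linsᵈ-mapMaybe []           = refl
linsᵈ-mapMaybe (lin M ∷ P)  = cong (M ᵈ ∷_) (linsᵈ-mapMaybe P)
linsᵈ-mapMaybe (bang M ∷ P) = linsᵈ-mapMaybe P

bangsᵈ-mapMaybe : ∀ P → bangsᵈ P ≡ mapMaybe bangᵈ? P
bangsᵈ-mapMaybe []           = refl
bangsᵈ-mapMaybe (lin M ∷ P)  = bangsᵈ-mapMaybe P
bangsᵈ-mapMaybe (bang M ∷ P) = cong (M ᵈ ∷_) (bangsᵈ-mapMaybe P)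

linsᵈ-↭ : ∀ {P Q} → P ↭ Q → linsᵈ P ↭ linsᵈ Q
linsᵈ-↭ {P} {Q} p = begin
  linsᵈ P               ≡⟨ linsᵈ-mapMaybe P ⟩
  mapMaybe linᵈ? P      ↭⟨ mapMaybe-↭ linᵈ? p ⟩
  mapMaybe linᵈ? Q      ≡⟨ linsᵈ-mapMaybe Q ⟨
  linsᵈ Q               ∎
  where open PermutationReasoning

bangsᵈ-↭ : ∀ {P Q} → P ↭ Q → bangsᵈ P ↭ bangsᵈ Q
bangsᵈ-↭ {P} {Q} p = begin
  bangsᵈ P              ≡⟨ bangsᵈ-mapMaybe P ⟩
  mapMaybe bangᵈ? P     ↭⟨ mapMaybe-↭ bangᵈ? p ⟩
  mapMaybe bangᵈ? Q     ≡⟨ bangsᵈ-mapMaybe Q ⟨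
  bangsᵈ Q              ∎
  where open PermutationReasoning

appBagᵈ-↭ : ∀ s B {P Q} → P ↭ Q → [ appBagᵈ s B P ] ≈d [ appBagᵈ s B Q ]
appBagᵈ-↭ s B p = d-app (∼⇒≈d (Dn-↭ s (linsᵈ-↭ p))) (d-sum (d-refl {B}) (d-perm (bangsᵈ-↭ p)))

linsᵈ-map-lin-bang : ∀ Ls Ns → linsᵈ (map lin Ls ++ map bang Ns) ≡ Ls ᵈˢ
linsᵈ-map-lin-bang []       []       = refl
linsᵈ-map-lin-bang []       (N ∷ Ns) = linsᵈ-map-lin-bang [] Ns
linsᵈ-map-lin-bang (L ∷ Ls) Ns       = cong (L ᵈ ∷_) (linsᵈ-map-lin-bang Ls Ns)

bangsᵈ-map-lin-bang : ∀ Ls Ns → bangsᵈ (map lin Ls ++ map bang Ns) ≡ Ns ᵈˢ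
bangsᵈ-map-lin-bang []       []       = refl
bangsᵈ-map-lin-bang []       (N ∷ Ns) = cong (N ᵈ ∷_) (bangsᵈ-map-lin-bang [] Ns)
bangsᵈ-map-lin-bang (L ∷ Ls) Ns       = bangsᵈ-map-lin-bang Ls Ns

β-ᵈ : ∀ M Ls Ns → [ app (lam M) (map lin Ls ++ map bang Ns) ᵈ ] ≈d
                  rsubS 0 Ns (lsubs 0 (map (shiftR 0) Ls) [ M ]) ᵈˢ
β-ᵈ M Ls Ns = begin
  [ app (Dn (lam (M ᵈ)) (linsᵈ bag)) (bangsᵈ bag) ]
    ≡⟨ cong₂ (λ ts U → [ app (Dn (lam (M ᵈ)) ts) U ]) (linsᵈ-map-lin-bang Ls Ns) (bangsᵈ-map-lin-bang Ls Ns) ⟩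
  [ app (Dn (lam (M ᵈ)) (Ls ᵈˢ)) (Ns ᵈˢ) ]
    ≡⟨ cong (λ S → appDS S (Ns ᵈˢ)) (DnS-[-] (lam (M ᵈ)) (Ls ᵈˢ)) ⟨
  appDS (DnS [ lam (M ᵈ) ] (Ls ᵈˢ)) (Ns ᵈˢ)
    ≈⟨ d-app (DnS-map-lam-β [ M ᵈ ] (Ls ᵈˢ)) d-refl ⟩
  appDS (map lam (dsubsD 0 (map (shiftD 0) (Ls ᵈˢ)) [ M ᵈ ])) (Ns ᵈˢ)
    ≈⟨ appDS-map-lam-β (dsubsD 0 (map (shiftD 0) (Ls ᵈˢ)) [ M ᵈ ]) (Ns ᵈˢ) ⟩
  subDS 0 (Ns ᵈˢ) (dsubsD 0 (map (shiftD 0) (Ls ᵈˢ)) [ M ᵈ ])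
    ≈⟨ ∼⇒≈d (subDS-resp-∼ 0 (Ns ᵈˢ) linear) ⟨
  subDS 0 (Ns ᵈˢ) (lsubs 0 (map (shiftR 0) Ls) [ M ] ᵈˢ)
    ≈⟨ ∼⇒≈d (rsubSᵈ 0 Ns (lsubs 0 (map (shiftR 0) Ls) [ M ])) ⟨
  rsubS 0 Ns (lsubs 0 (map (shiftR 0) Ls) [ M ]) ᵈˢ
    ∎
  where
  open ≈d-Reasoning
  bag = map lin Ls ++ map bang Ns
  linear : lsubs 0 (map (shiftR 0) Ls) [ M ] ᵈˢ ∼ dsubsD 0 (map (shiftD 0) (Ls ᵈˢ)) [ M ᵈ ]
  linear = ∼-trans (lsubsᵈ 0 (map (shiftR 0) Ls) [ M ])
                   (∼-reflexive (cong (λ ts → dsubsD 0 ts [ M ᵈ ])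
                                      (≡.trans (map-shiftR-ᵈˢ 0 Ls) (shiftDS-map 0 (Ls ᵈˢ)))))

mutual
  ≈r⇒≈d : ∀ {S S'} → S ≈r S' → S ᵈˢ ≈d S' ᵈˢ
  ≈r⇒≈d r-refl           = d-refl
  ≈r⇒≈d (r-sym p)        = d-sym (≈r⇒≈d p)
  ≈r⇒≈d (r-trans p q)    = d-trans (≈r⇒≈d p) (≈r⇒≈d q)
  ≈r⇒≈d (r-perm p)       = d-perm (map⁺ _ᵈ p)
  ≈r⇒≈d (r-lam {𝕄 = 𝕄} p) = d-trans (d-lam (≈r⇒≈d p)) (≈d-reflexive (≡.sym (lamS-ᵈ 𝕄)))
  ≈r⇒≈d (r-app {M} {𝕄} {P} {ℙ} p q) = begin
    [ app M P ᵈ ]               ≈⟨ ≈b⇒≈d q (M ᵈ) [] ⟩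
    map (appBagᵈ (M ᵈ) []) ℙ    ≡⟨ ++-identityʳ _ ⟨
    appBagsᵈ [ M ᵈ ] [] ℙ       ≈⟨ appBagsᵈ-congˡ [] ℙ (≈r⇒≈d p) ⟩
    appBagsᵈ (𝕄 ᵈˢ) [] ℙ        ≡⟨ appS-ᵈ 𝕄 ℙ ⟨
    appS 𝕄 ℙ ᵈˢ                 ∎
    where open ≈d-Reasoning
  ≈r⇒≈d (r-sum ps)       = ≈r⇒≈d-sum ps
  ≈r⇒≈d (r-beta M Ls Ns) = β-ᵈ M Ls Ns

  ≈r⇒≈d-sum : ∀ {Ms 𝕄s} → Pointwise (λ M 𝕄 → [ M ] ≈r 𝕄) Ms 𝕄s → Ms ᵈˢ ≈d concat 𝕄s ᵈˢ
  ≈r⇒≈d-sum []                               = d-refl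
  ≈r⇒≈d-sum (_∷_ {y = 𝕄} {ys = 𝕄s} p ps) =
    d-trans (d-sum (≈r⇒≈d p) (≈r⇒≈d-sum ps)) (≈d-reflexive (≡.sym (map-++ _ᵈ 𝕄 (concat 𝕄s))))

  -- Generalised over the head s and the reusable resources B, which the rules
  -- b-lin and b-bang change.
  ≈b⇒≈d : ∀ {Ps Qs} → Ps ≈b Qs → ∀ s B → map (appBagᵈ s B) Ps ≈d map (appBagᵈ s B) Qs
  ≈b⇒≈d b-refl        s B = d-refl
  ≈b⇒≈d (b-sym p)     s B = d-sym (≈b⇒≈d p s B)
  ≈b⇒≈d (b-trans p q) s B = d-trans (≈b⇒≈d p s B) (≈b⇒≈d q s B)
  ≈b⇒≈d (b-perm p)    s B = d-perm (map⁺ (appBagᵈ s B) p)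
  ≈b⇒≈d (b-bagperm p) s B = appBagᵈ-↭ s B p
  ≈b⇒≈d (b-lin {M} {𝕄} {P} {ℙ} p q) s B = begin
    [ appBagᵈ (dap s (M ᵈ)) B P ]        ≈⟨ ≈b⇒≈d q (dap s (M ᵈ)) B ⟩
    map (appBagᵈ (dap s (M ᵈ)) B) ℙ      ≡⟨ ++-identityʳ _ ⟨
    appBagsᵈ [ dap s (M ᵈ) ] B ℙ         ≈⟨ appBagsᵈ-congˡ B ℙ (d-dap (d-refl {[ s ]}) (≈r⇒≈d p)) ⟩
    appBagsᵈ (dapDS [ s ] (𝕄 ᵈˢ)) B ℙ    ≡⟨ appBagsᵈ-consLin [ s ] B 𝕄 ℙ ⟨
    appBagsᵈ [ s ] B (consLin 𝕄 ℙ)       ≡⟨ ++-identityʳ _ ⟩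
    map (appBagᵈ s B) (consLin 𝕄 ℙ)      ∎
    where open ≈d-Reasoning
  ≈b⇒≈d (b-bang {M} {𝕄} {P} {ℙ} p q) s B = begin
    [ appBagᵈ s B (bang M ∷ P) ]         ≡⟨ cong [_] (appBagᵈ-bang s B M P) ⟩
    [ appBagᵈ s (B ++ [ M ᵈ ]) P ]       ≈⟨ ≈b⇒≈d q s (B ++ [ M ᵈ ]) ⟩
    map (appBagᵈ s (B ++ [ M ᵈ ])) ℙ     ≈⟨ map-appBagᵈ-congʳ s ℙ (d-sum (d-refl {B}) (≈r⇒≈d p)) ⟩
    map (appBagᵈ s (B ++ 𝕄 ᵈˢ)) ℙ        ≡⟨ map-appBagᵈ-consBang s B 𝕄 ℙ ⟨
    map (appBagᵈ s B) (consBang 𝕄 ℙ)     ∎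
    where open ≈d-Reasoning
  ≈b⇒≈d (b-sum ps)    s B = ≈b⇒≈d-sum ps s B

  ≈b⇒≈d-sum : ∀ {Ps ℙs} → Pointwise (λ P ℙ → [ P ] ≈b ℙ) Ps ℙs → ∀ s B →
              map (appBagᵈ s B) Ps ≈d map (appBagᵈ s B) (concat ℙs)
  ≈b⇒≈d-sum []                               s B = d-refl
  ≈b⇒≈d-sum (_∷_ {y = ℙ} {ys = ℙs} p ps) s B =
    d-trans (d-sum (≈b⇒≈d p s B) (≈b⇒≈d-sum ps s B))
            (≈d-reflexive (≡.sym (map-++ (appBagᵈ s B) ℙ (concat ℙs))))

proposition6p11 : (M : RTerm) (N : RSum) → (M ∷ []) ≈r N → ((M ᵈ) ∷ []) ≈d (N ᵈˢ)
proposition6p11 M N = ≈r⇒≈d
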